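{- Let $G$ be a finite graph and $t\ge 0$ an integer. Let $p$ be the largest integer such that some $t$-shallow minor of $G$ is isomorphic to the complete bipartite graph $K_{p,p}$. Then $\hat\beta_t(G)\ge p$.
   Context: All graphs are finite, simple and undirected. A $t$-shallow minor ($t$-minor) of $G$ is a graph $H$ obtained from $G$ by choosing pairwise disjoint vertex sets $V_1,\dots,V_m\subseteq V(G)$, each inducing a connected subgraph of radius at most $t$, contracting each $V_i$ to a single vertex $v_i$ and deleting all other vertices; thus $V(H)=\{v_1,\dots,v_m\}$, and $v_iv_j$ ($i\neq j$) is an edge of $H$ iff $G$ has an edge between $V_i$ and $V_j$. For a graph $H$, $\beta(H)$ is the clique cover number of $H$: the minimum number of pairwise disjoint cliques partitioning $V(H)$. For $x\in V(H)$, $H_x$ denotes the subgraph of $H$ induced by the closed neighborhood of $x$ (i.e. $x$ together with its neighbors). Define $\tilde\beta(H)=\min_{x\in V(H)}\beta(H_x)$. For a graph $G$ and $t\ge 0$, the largest reduced neighborhood clique cover number $\hat\beta_t(G)$ is the maximum of $\tilde\beta(H)$ over all $t$-shallow minors $H$ of $G$. -}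

module Defs where

open import Data.Nat using (ℕ; zero; suc; _<_; _≤_)
open import Data.Fin using (Fin; toℕ)
open import Data.Maybe using (Maybe; just; nothing)
open import Data.Product using (Σ; ∃; _×_; _,_)
open import Data.Sum using (_⊎_)
open import Data.Empty using (⊥)
open import Relation.Nullary using (¬_)
open import Relation.Binary.PropositionalEquality using (_≡_; _≢_)
open import Function.Bundles using (_⇔_; _↔_; Inverse)

record Graph (n : ℕ) : Set₁ where
  field
    Adj   : Fin n → Fin n → Set
    sym   : ∀ {u v} → Adj u v → Adj v u
    irrefl : ∀ {u} → ¬ Adj u u
open Graph public

_≅_ : ∀ {m n} → Graph m → Graph n → Set
_≅_ {m} {n} H K =
  Σ (Fin m ↔ Fin n) λ f →
    ∀ u v → Adj H u v ⇔ Adj K (Inverse.to f u) (Inverse.to f v)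

K : (p : ℕ) → Graph (p Data.Nat.+ p)
K p = record
  { Adj = λ i j → (toℕ i < p × p ≤ toℕ j) ⊎ (p ≤ toℕ i × toℕ j < p)
  ; sym = λ { (Data.Sum.inj₁ (a , b)) → Data.Sum.inj₂ (b , a)
            ; (Data.Sum.inj₂ (a , b)) → Data.Sum.inj₁ (b , a) }
  ; irrefl = λ { (Data.Sum.inj₁ (a , b)) → Data.Nat.Properties.<⇒≱ a b
               ; (Data.Sum.inj₂ (a , b)) → Data.Nat.Properties.<⇒≱ b a } }
  where import Data.Nat.Properties

data Walk {n} (G : Graph n) (P : Fin n → Set) : Fin n → Fin n → ℕ → Set where
  here : ∀ {u} → P u → Walk G P u u 0
  step : ∀ {u w v k} → P u → Adj G u w → Walk G P w v k → Walk G P u v (suc k)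

-- H (on Fin m) is a t-shallow minor of G (on Fin n).
-- φ v = just i means v belongs to branch set V_i; φ v = nothing means v is deleted
-- (so branch sets are pairwise disjoint by construction).
-- Each V_i has a centre c i ∈ V_i such that every vertex of V_i is at distance ≤ t
-- from c i in G[V_i]  (i.e. G[V_i] is connected of radius ≤ t).
record ShallowMinorModel {n m} (t : ℕ) (G : Graph n) (H : Graph m) : Set where
  field
    φ       : Fin n → Maybe (Fin m)
    centre  : Fin m → Fin n
    centre∈ : ∀ i → φ (centre i) ≡ just i
    radius  : ∀ i v → φ v ≡ just i →
              Σ ℕ λ k → k ≤ t × Walk G (λ u → φ u ≡ just i) (centre i) v k
    edges   : ∀ i j → Adj H i j ⇔
              (i ≢ j × Σ (Fin n) λ u → Σ (Fin n) λ v →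
                 φ u ≡ just i × φ v ≡ just j × Adj G u v)

IsShallowMinor : ∀ {n m} → ℕ → Graph n → Graph m → Set
IsShallowMinor t G H = ShallowMinorModel t G H

CliqueCoverOn : ∀ {m} → Graph m → (Fin m → Set) → ℕ → Set
CliqueCoverOn {m} H S k =
  Σ ((v : Fin m) → S v → Fin k) λ c →
    ∀ u v (su : S u) (sv : S v) → c u su ≡ c v sv → u ≢ v → Adj H u v

N[_,_] : ∀ {m} → Graph m → Fin m → Fin m → Set
N[ H , x ] v = v ≡ x ⊎ Adj H x v

βOnAtLeast : ∀ {m} → Graph m → (Fin m → Set) → ℕ → Set
βOnAtLeast H S p = ∀ k → CliqueCoverOn H S k → p ≤ k

-- β̃(H) ≥ p : β(H_x) ≥ p for every vertex x (min over x).
-- Convention: for the empty graph β̃ = 0 (the minimum over the empty set is taken as 0).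
β̃AtLeast : ∀ {m} → Graph m → ℕ → Set
β̃AtLeast {m} H p = (p ≡ 0 ⊎ 0 < m) × (∀ x → βOnAtLeast H N[ H , x ] p)

β̂AtLeast : ∀ {n} → ℕ → Graph n → ℕ → Set₁
β̂AtLeast {n} t G p = Σ ℕ λ m → Σ (Graph m) λ H → IsShallowMinor t G H × β̃AtLeast H p

HasKppMinor : ∀ {n} → ℕ → Graph n → ℕ → Set₁
HasKppMinor t G p = Σ ℕ λ m → Σ (Graph m) λ H → IsShallowMinor t G H × (H ≅ K p)

-- In K_{p,p} the neighbourhood of every vertex contains the opposite part, an independent
-- set of size p. A clique partition of H_x must put the p vertices of an independent set into
-- p different cliques, so taking H to be the minor isomorphic to K_{p,p} gives β̃(H) ≥ p.
module Submission where

open import Defs hiding (sym)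
open import Data.Nat using (ℕ; zero; suc; _≤_; _<_; _+_; >-nonZero⁻¹)
open import Data.Nat.Properties using (<⇒≱; m≤m+n; _<?_; ≮⇒≥)
open import Data.Fin using (Fin; zero; toℕ; _↑ˡ_; _↑ʳ_; _≟_)
open import Data.Fin.Properties using (toℕ-↑ˡ; toℕ-↑ʳ; ↑ˡ-injective; ↑ʳ-injective; injective⇒≤; toℕ<n; nonZeroIndex)
open import Data.Product using (_,_)
open import Data.Sum using (_⊎_; inj₁; inj₂)
open import Data.Empty using (⊥-elim)
open import Relation.Nullary using (¬_; yes; no)
open import Relation.Binary.PropositionalEquality using (_≡_; refl; sym; trans; cong; subst; subst₂)
open import Function using (_∘_)
open import Function.Bundles using (Inverse; Equivalence; _↔_)

record IndependentSetIn {m} (H : Graph m) (S : Fin m → Set) (p : ℕ) : Set where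
  field
    vertex      : Fin p → Fin m
    injective   : ∀ {i j} → vertex i ≡ vertex j → i ≡ j
    inside      : ∀ i → S (vertex i)
    independent : ∀ i j → ¬ Adj H (vertex i) (vertex j)

module _ {m} {H : Graph m} {S : Fin m → Set} {p : ℕ} where

  independentSet-mono : ∀ {T : Fin m → Set} → (∀ {v} → S v → T v) →
    IndependentSetIn H S p → IndependentSetIn H T p
  independentSet-mono S⊆T I = record
    { vertex = vertex ; injective = injective ; inside = S⊆T ∘ inside ; independent = independent }
    where open IndependentSetIn I

  independentSet⇒βOnAtLeast : IndependentSetIn H S p → βOnAtLeast H S p
  independentSet⇒βOnAtLeast I k (class , sameClass⇒adj) = injective⇒≤ classOf-injective
    where
    open IndependentSetIn I
    classOf : Fin p → Fin k
    classOf i = class (vertex i) (inside i)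
    classOf-injective : ∀ {i j} → classOf i ≡ classOf j → i ≡ j
    classOf-injective {i} {j} eq with i ≟ j
    ... | yes i≡j = i≡j
    ... | no i≢j  = ⊥-elim (independent i j
      (sameClass⇒adj (vertex i) (vertex j) (inside i) (inside j) eq (i≢j ∘ injective)))

independentSet-pullback : ∀ {m n} (H : Graph m) (L : Graph n) {p : ℕ} →
  ((f , iso) : H ≅ L) (x : Fin m) →
  IndependentSetIn L (Adj L (Inverse.to f x)) p → IndependentSetIn H (Adj H x) p
independentSet-pullback H L (f , iso) x I = record
  { vertex      = from ∘ vertex
  ; injective   = λ {i} {j} eq → injective (trans (sym (to∘from (vertex i)))
                                             (trans (cong to eq) (to∘from (vertex j))))
  ; inside      = λ i → Equivalence.from (iso x (from (vertex i)))
                          (subst (Adj L (to x)) (sym (to∘from (vertex i))) (inside i))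
  ; independent = λ i j adj → independent i j
      (subst₂ (Adj L) (to∘from (vertex i)) (to∘from (vertex j))
        (Equivalence.to (iso (from (vertex i)) (from (vertex j))) adj))
  }
  where
  open IndependentSetIn I
  open Inverse f using (to; from)
  to∘from : ∀ y → to (from y) ≡ y
  to∘from = Inverse.strictlyInverseˡ f

module _ (p : ℕ) where

  toℕ-↑ˡ-< : ∀ (i : Fin p) → toℕ (i ↑ˡ p) < p
  toℕ-↑ˡ-< i = subst (_< p) (sym (toℕ-↑ˡ i p)) (toℕ<n i)

  toℕ-↑ʳ-≥ : ∀ (i : Fin p) → p ≤ toℕ (p ↑ʳ i)
  toℕ-↑ʳ-≥ i = subst (p ≤_) (sym (toℕ-↑ʳ p i)) (m≤m+n p (toℕ i))

  K-left-nonadjacent : ∀ {u v} → toℕ u < p → toℕ v < p → ¬ Adj (K p) u v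
  K-left-nonadjacent _ v<p (inj₁ (_ , p≤v)) = <⇒≱ v<p p≤v
  K-left-nonadjacent u<p _ (inj₂ (p≤u , _)) = <⇒≱ u<p p≤u

  K-right-nonadjacent : ∀ {u v} → p ≤ toℕ u → p ≤ toℕ v → ¬ Adj (K p) u v
  K-right-nonadjacent p≤u _ (inj₁ (u<p , _)) = <⇒≱ u<p p≤u
  K-right-nonadjacent _ p≤v (inj₂ (_ , v<p)) = <⇒≱ v<p p≤v

  K-neighbourhood-independentSet : ∀ y → IndependentSetIn (K p) (Adj (K p) y) p
  K-neighbourhood-independentSet y with toℕ y <? p
  ... | yes y<p = record
    { vertex      = p ↑ʳ_
    ; injective   = ↑ʳ-injective p _ _
    ; inside      = λ i → inj₁ (y<p , toℕ-↑ʳ-≥ i)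
    ; independent = λ i j → K-right-nonadjacent (toℕ-↑ʳ-≥ i) (toℕ-↑ʳ-≥ j)
    }
  ... | no y≮p = record
    { vertex      = _↑ˡ p
    ; injective   = ↑ˡ-injective p _ _
    ; inside      = λ i → inj₂ (≮⇒≥ y≮p , toℕ-↑ˡ-< i)
    ; independent = λ i j → K-left-nonadjacent (toℕ-↑ˡ-< i) (toℕ-↑ˡ-< j)
    }

zero-or-inhabited : ∀ {m} p → Fin m ↔ Fin (p + p) → p ≡ 0 ⊎ 0 < m
zero-or-inhabited zero    _ = inj₁ refl
zero-or-inhabited {m} (suc _) f = inj₂ (>-nonZero⁻¹ m {{nonZeroIndex (Inverse.from f zero)}})

≅K⇒β̃AtLeast : ∀ {m} (H : Graph m) (p : ℕ) → H ≅ K p → β̃AtLeast H p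
≅K⇒β̃AtLeast H p (f , iso) = zero-or-inhabited p f , λ x →
  independentSet⇒βOnAtLeast (independentSet-mono inj₂
    (independentSet-pullback H (K p) (f , iso) x (K-neighbourhood-independentSet p (Inverse.to f x))))

mainTheorem1 : ∀ {n} (G : Graph n) (t p : ℕ) →
    HasKppMinor t G p →
    (∀ q → HasKppMinor t G q → q ≤ p) →
    β̂AtLeast t G p
mainTheorem1 G t p (m , H , model , H≅K) _ = m , H , model , ≅K⇒β̃AtLeast H p H≅K
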